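{- Let $n\geq 1$, let $\mathcal{C}_n$ be the set of compositions of $n$ into parts equal to $1$ or $2$, i.e. sequences $(r_1,\dots,r_k)$ with $k\geq 1$, $r_i\in\{1,2\}$ and $r_1+\cdots+r_k=n$. Let $P_3$ be the POP of size 3 with the single relation $1>3$. Define $f:\mathcal{C}_n\to Av_n(P_3)$ by \[f(r_1+\cdots+r_k)=\alpha_1\oplus\alpha_2\oplus\cdots\oplus\alpha_k,\qquad \alpha_i=\begin{cases}1 & \text{if } r_i=1,\\ 21 & \text{if } r_i=2.\end{cases}\] Then $f$ is a bijection from $\mathcal{C}_n$ onto $Av_n(P_3)$.
   Context: A POP of size $k$ is a poset on $\{1,\dots,k\}$; an $n$-permutation $\pi$ contains it if there are indices $i_1<\cdots<i_k$ with $\pi_{i_a}<\pi_{i_b}$ whenever $a<b$ in the poset. So $\pi$ contains $P_3$ iff there are $i_1<i_2<i_3$ with $\pi_{i_1}>\pi_{i_3}$. $Av_n(P_3)$ is the set of $n$-permutations avoiding $P_3$. The direct sum $\alpha\oplus\beta$ of permutations of lengths $a,b$ is $\alpha_1\cdots\alpha_a(\beta_1+a)\cdots(\beta_b+a)$. -}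

module Defs where

open import Data.Nat using (ℕ; zero; suc; _+_)
open import Data.Fin using (Fin; zero; suc; _<_; _↑ˡ_; _↑ʳ_)
open import Data.Vec using (Vec; []; _∷_; _++_; map; lookup)
open import Data.Product using (∃; _×_)
open import Function.Definitions using (Bijective)
open import Relation.Nullary using (¬_)
open import Relation.Binary.PropositionalEquality using (_≡_)

-- Permutations of length n in one-line notation: π = π₁ … πₙ with values in
-- Fin n (value v stands for v+1), such that i ↦ πᵢ is a bijection.
IsPerm : {n : ℕ} → Vec (Fin n) n → Set
IsPerm {n} π = Bijective {A = Fin n} {B = Fin n} _≡_ _≡_ (lookup π)

-- A POP of size k is given by its strict order relation a <_P b on Fin k
-- (positions 1..k are Fin k values 0..k-1).
-- π contains the POP if there are indices i₁ < ⋯ < i_k with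
-- π_{i_a} < π_{i_b} whenever a <_P b.
Contains : {k n : ℕ} → (Fin k → Fin k → Set) → Vec (Fin n) n → Set
Contains {k} {n} R π =
  ∃ λ (idx : Fin k → Fin n) →
    (∀ a b → a < b → idx a < idx b) ×
    (∀ a b → R a b → lookup π (idx a) < lookup π (idx b))

Avoids : {k n : ℕ} → (Fin k → Fin k → Set) → Vec (Fin n) n → Set
Avoids R π = ¬ Contains R π

-- P₃ : the POP of size 3 whose only relation is 1 > 3, i.e. 3 <_P 1.
data P₃ : Fin 3 → Fin 3 → Set where
  three<one : P₃ (suc (suc zero)) zero

_⊕_ : {a b : ℕ} → Vec (Fin a) a → Vec (Fin b) b → Vec (Fin (a + b)) (a + b)
_⊕_ {a} {b} α β = map (_↑ˡ b) α ++ map (a ↑ʳ_) β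

data Comp : ℕ → Set where
  []   : Comp zero
  1∷_  : {n : ℕ} → Comp n → Comp (suc n)
  2∷_  : {n : ℕ} → Comp n → Comp (suc (suc n))

perm1 : Vec (Fin 1) 1
perm1 = zero ∷ []

perm21 : Vec (Fin 2) 2
perm21 = suc zero ∷ zero ∷ []

-- f(r₁+⋯+r_k) = α₁ ⊕ (α₂ ⊕ (⋯ ⊕ α_k)) (⊕ is associative); empty sum for n = 0.
f : {n : ℕ} → Comp n → Vec (Fin n) n
f []       = []
f (1∷ c)   = perm1 ⊕ f c
f (2∷ c)   = perm21 ⊕ f c

-- The permutations α₁ ⊕ ⋯ ⊕ α_k with αᵢ ∈ {1, 21} are exactly the permutations π
-- with πᵢ < π_k whenever k ≥ i + 2: the first entry exceeds at most one later entry,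
-- namely its neighbour. For a permutation this property is equivalent to avoiding P₃,
-- since an occurrence π_{i₁} > π_{i₃} with i₁ < i₂ < i₃ is exactly a violation of it.
-- Conversely, in a permutation of {o, …, o+n−1} with the property, the value o sits at
-- position 1 (so the first block is 1) or at position 2 with o+1 at position 1 (so it
-- is 21); removing that block leaves a permutation of the remaining values with the
-- property, and induction reads off the composition.
module Submission where

open import Defs
open import Data.Nat using (ℕ; zero; suc; _+_; _≤_; _≥_; z≤n; s≤s)
import Data.Nat as ℕ
open import Data.Nat.Properties
  using (≤-trans; ≤-antisym; <-irrefl; <-trans; n<1+n; <⇒≤; <⇒≱; ≤∧≢⇒<; +-suc; +-identityʳ; 1+n≢n; m≢1+n+m)
open import Data.Fin using (Fin; zero; suc; toℕ; fromℕ<; _<_)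
open import Data.Fin.Properties using (toℕ-fromℕ<; toℕ-injective; 0≢1+n; suc-injective; toℕ<n; <-cmp; <-asym)
open import Data.Vec using (Vec; lookup)
open import Data.Vec.Properties using (lookup-map; tabulate∘lookup; tabulate-cong)
open import Data.Product using (∃; _×_; _,_)
open import Data.Empty using (⊥-elim)
open import Function using (_∘_)
open import Function.Definitions using (Injective; Bijective)
open import Function.Consequences using (inverseᵇ⇒bijective)
open import Relation.Binary.Definitions using (tri<; tri≈; tri>)
open import Relation.Binary.PropositionalEquality
  using (_≡_; _≗_; refl; sym; trans; cong; subst; subst₂)

lookup-≗⇒≡ : ∀ {A : Set} {n} (xs ys : Vec A n) → lookup xs ≗ lookup ys → xs ≡ ys
lookup-≗⇒≡ xs ys eq =
  trans (sym (tabulate∘lookup xs)) (trans (tabulate-cong eq) (tabulate∘lookup ys))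

involutive⇒bijective : ∀ {A : Set} {h : A → A} → (∀ x → h (h x) ≡ x) → Bijective _≡_ _≡_ h
involutive⇒bijective {h = h} inv =
  inverseᵇ⇒bijective _≡_ refl sym trans ((λ { refl → inv _ }) , (λ { refl → inv _ }))

FarIncreasing : {n : ℕ} → (Fin n → ℕ) → Set
FarIncreasing p = ∀ i k → 2 + toℕ i ≤ toℕ k → p i ℕ.< p k

FarIncreasing-∘suc : ∀ {n} {p : Fin (suc n) → ℕ} → FarIncreasing p → FarIncreasing (p ∘ suc)
FarIncreasing-∘suc far i k h = far (suc i) (suc k) (s≤s h)

+-suc² : ∀ m n → m + suc (suc n) ≡ suc (suc (m + n))
+-suc² m n = trans (+-suc m (suc n)) (cong suc (+-suc m n))

toFun : ∀ {n} → Comp n → Fin n → Fin n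
toFun (1∷ c) zero          = zero
toFun (1∷ c) (suc i)       = suc (toFun c i)
toFun (2∷ c) zero          = suc zero
toFun (2∷ c) (suc zero)    = zero
toFun (2∷ c) (suc (suc i)) = suc (suc (toFun c i))

lookup-f : ∀ {n} (c : Comp n) → lookup (f c) ≗ toFun c
lookup-f (1∷ c) zero          = refl
lookup-f (1∷ c) (suc i)       = trans (lookup-map i _ (f c)) (cong suc (lookup-f c i))
lookup-f (2∷ c) zero          = refl
lookup-f (2∷ c) (suc zero)    = refl
lookup-f (2∷ c) (suc (suc i)) = trans (lookup-map i _ (f c)) (cong (λ j → suc (suc j)) (lookup-f c i))

toFun-involutive : ∀ {n} (c : Comp n) i → toFun c (toFun c i) ≡ i
toFun-involutive (1∷ c) zero          = refl
toFun-involutive (1∷ c) (suc i)       = cong suc (toFun-involutive c i)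
toFun-involutive (2∷ c) zero          = refl
toFun-involutive (2∷ c) (suc zero)    = refl
toFun-involutive (2∷ c) (suc (suc i)) = cong (λ j → suc (suc j)) (toFun-involutive c i)

toFun-farIncreasing : ∀ {n} (c : Comp n) → FarIncreasing (toℕ ∘ toFun c)
toFun-farIncreasing (1∷ c) zero          (suc k)       _             = s≤s z≤n
toFun-farIncreasing (1∷ c) (suc i)       (suc k)       (s≤s h)       = s≤s (toFun-farIncreasing c i k h)
toFun-farIncreasing (2∷ c) zero          (suc (suc k)) _             = s≤s (s≤s z≤n)
toFun-farIncreasing (2∷ c) (suc zero)    (suc (suc k)) _             = s≤s z≤n
toFun-farIncreasing (2∷ c) (suc (suc i)) (suc (suc k)) (s≤s (s≤s h)) = s≤s (s≤s (toFun-farIncreasing c i k h))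
toFun-farIncreasing (2∷ c) zero          (suc zero)    (s≤s ())
toFun-farIncreasing (2∷ c) (suc zero)    (suc zero)    (s≤s ())

toFun-injective : ∀ {n} {c d : Comp n} → toFun c ≗ toFun d → c ≡ d
toFun-injective {c = []}   {[]}   _  = refl
toFun-injective {c = 1∷ c} {1∷ d} eq = cong 1∷_ (toFun-injective (λ i → suc-injective (eq (suc i))))
toFun-injective {c = 2∷ c} {2∷ d} eq =
  cong 2∷_ (toFun-injective (λ i → suc-injective (suc-injective (eq (suc (suc i))))))
toFun-injective {c = 1∷ c} {2∷ d} eq with eq zero
... | ()
toFun-injective {c = 2∷ c} {1∷ d} eq with eq zero
... | ()

f-isPerm : ∀ {n} (c : Comp n) → IsPerm (f c)
f-isPerm c = involutive⇒bijective λ i →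
  trans (lookup-f c _) (trans (cong (toFun c) (lookup-f c i)) (toFun-involutive c i))

f-injective : ∀ {n} {c d : Comp n} → f c ≡ f d → c ≡ d
f-injective {c = c} {d} eq =
  toFun-injective λ i → trans (sym (lookup-f c i)) (trans (cong (λ v → lookup v i) eq) (lookup-f d i))

contains-P₃ : ∀ {n} (π : Vec (Fin n) n) {i j k : Fin n} →
  i < j → j < k → lookup π k < lookup π i → Contains P₃ π
contains-P₃ π {i} {j} {k} i<j j<k πk<πi = idx , increasing , πk<πi′
  where
  idx : Fin 3 → Fin _
  idx zero             = i
  idx (suc zero)       = j
  idx (suc (suc zero)) = k
  increasing : ∀ a b → a < b → idx a < idx b
  increasing zero             (suc zero)       _ = i<j
  increasing zero             (suc (suc zero)) _ = <-trans i<j j<k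
  increasing (suc zero)       (suc (suc zero)) _ = j<k
  increasing zero             zero             ()
  increasing (suc zero)       zero             ()
  increasing (suc zero)       (suc zero)       (s≤s ())
  increasing (suc (suc zero)) zero             ()
  increasing (suc (suc zero)) (suc zero)       (s≤s ())
  increasing (suc (suc zero)) (suc (suc zero)) (s≤s (s≤s ()))
  πk<πi′ : ∀ a b → P₃ a b → lookup π (idx a) < lookup π (idx b)
  πk<πi′ _ _ three<one = πk<πi

farIncreasing⇒avoids : ∀ {n} (π : Vec (Fin n) n) → FarIncreasing (toℕ ∘ lookup π) → Avoids P₃ π
farIncreasing⇒avoids π far (idx , increasing , related) =
  <-asym (related _ _ three<one) (far (idx zero) (idx (suc (suc zero))) far-apart)
  where
  far-apart : 2 + toℕ (idx zero) ≤ toℕ (idx (suc (suc zero)))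
  far-apart = ≤-trans (s≤s (increasing zero (suc zero) (s≤s z≤n)))
                      (increasing (suc zero) (suc (suc zero)) (s≤s (s≤s z≤n)))

f-avoids : ∀ {n} (c : Comp n) → Avoids P₃ (f c)
f-avoids c = farIncreasing⇒avoids (f c) λ i k far-apart →
  subst₂ _<_ (sym (lookup-f c i)) (sym (lookup-f c k)) (toFun-farIncreasing c i k far-apart)

-- An inversion at distance at least 2 is an occurrence of P₃, with the next position as middle entry.
avoids⇒farIncreasing : ∀ {n} (π : Vec (Fin n) n) → Injective _≡_ _≡_ (lookup π) →
  Avoids P₃ π → FarIncreasing (toℕ ∘ lookup π)
avoids⇒farIncreasing {n} π injective avoids i k far-apart with <-cmp (lookup π i) (lookup π k)
... | tri< πi<πk _ _ = πi<πk
... | tri≈ _ πi≡πk _ = ⊥-elim (<-irrefl (cong toℕ (injective πi≡πk)) i<k)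
  where
  i<k : i < k
  i<k = <-trans (n<1+n _) far-apart
... | tri> _ _ πk<πi = ⊥-elim (avoids (contains-P₃ π i<j j<k πk<πi))
  where
  next<n : 1 + toℕ i ℕ.< n
  next<n = ≤-trans far-apart (<⇒≤ (toℕ<n k))
  j : Fin n
  j = fromℕ< next<n
  i<j : i < j
  i<j = subst (toℕ i ℕ.<_) (sym (toℕ-fromℕ< next<n)) (n<1+n _)
  j<k : j < k
  j<k = subst (ℕ._< toℕ k) (sym (toℕ-fromℕ< next<n)) far-apart

-- p is the one-line notation of a permutation of {o, …, o+n−1}; the upper bound on
-- the values follows from the other fields and is never needed.
record IsShiftedPerm (o : ℕ) {n : ℕ} (p : Fin n → ℕ) : Set where
  field
    injective : Injective _≡_ _≡_ p
    lower-bound   : ∀ x → o ≤ p x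
    covers    : ∀ y → y ℕ.< n → ∃ λ x → p x ≡ y + o

open IsShiftedPerm

data FirstBlock (o : ℕ) : ∀ {n} → (Fin n → ℕ) → Set where
  one     : ∀ {m} {p : Fin (suc m) → ℕ} → p zero ≡ o → FirstBlock o p
  twoOne  : ∀ {m} {p : Fin (suc (suc m)) → ℕ} →
            p zero ≡ suc o → p (suc zero) ≡ o → FirstBlock o p

firstBlock : ∀ {m o} {p : Fin (suc m) → ℕ} → IsShiftedPerm o p → FarIncreasing p → FirstBlock o p
firstBlock {o = o} {p} sp far with covers sp 0 (s≤s z≤n)
... | zero , p0≡o = one p0≡o
... | suc (suc x) , p≡o = ⊥-elim (<⇒≱ (subst (p zero ℕ.<_) p≡o (far zero (suc (suc x)) (s≤s (s≤s z≤n))))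
                                      (lower-bound sp zero))
... | suc zero , p1≡o with covers sp 1 (s≤s (s≤s z≤n))
...   | zero , p0≡1+o = twoOne p0≡1+o p1≡o
...   | suc zero , p1≡1+o = ⊥-elim (1+n≢n (trans (sym p1≡1+o) p1≡o))
...   | suc (suc x) , p≡1+o = ⊥-elim (0≢1+n (injective sp (trans p0≡o (sym p1≡o))))
  where
  p0≡o : p zero ≡ o
  p0≡o = ≤-antisym (ℕ.s≤s⁻¹ (subst (p zero ℕ.<_) p≡1+o (far zero (suc (suc x)) (s≤s (s≤s z≤n)))))
                   (lower-bound sp zero)

tail-one : ∀ {m o} {p : Fin (suc m) → ℕ} → IsShiftedPerm o p → p zero ≡ o →
  IsShiftedPerm (suc o) (p ∘ suc)
tail-one {o = o} {p} sp p0≡o = record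
  { injective = suc-injective ∘ injective sp
  ; lower-bound   = λ x → ≤∧≢⇒< (lower-bound sp (suc x)) (0≢1+n ∘ injective sp ∘ trans p0≡o)
  ; covers    = covers′
  }
  where
  covers′ : ∀ y → y ℕ.< _ → ∃ λ x → p (suc x) ≡ y + suc o
  covers′ y y<m with covers sp (suc y) (s≤s y<m)
  ... | zero  , p0≡1+y+o = ⊥-elim (m≢1+n+m o (trans (sym p0≡o) p0≡1+y+o))
  ... | suc x , p≡1+y+o  = x , trans p≡1+y+o (sym (+-suc y o))

tail-twoOne : ∀ {m o} {p : Fin (suc (suc m)) → ℕ} → IsShiftedPerm o p →
  p zero ≡ suc o → p (suc zero) ≡ o → IsShiftedPerm (2 + o) (λ x → p (suc (suc x)))
tail-twoOne {o = o} {p} sp p0≡1+o p1≡o = record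
  { injective = suc-injective ∘ suc-injective ∘ injective sp
  ; lower-bound   = λ x →
      ≤∧≢⇒< (≤∧≢⇒< (lower-bound sp (suc (suc x))) (0≢1+n ∘ suc-injective ∘ injective sp ∘ trans p1≡o))
            (0≢1+n ∘ injective sp ∘ trans p0≡1+o)
  ; covers    = covers′
  }
  where
  covers′ : ∀ y → y ℕ.< _ → ∃ λ x → p (suc (suc x)) ≡ y + suc (suc o)
  covers′ y y<m with covers sp (2 + y) (s≤s (s≤s y<m))
  ... | zero , p0≡2+y+o        = ⊥-elim (m≢1+n+m o (cong ℕ.pred (trans (sym p0≡1+o) p0≡2+y+o)))
  ... | suc zero , p1≡2+y+o    = ⊥-elim (m≢1+n+m o (trans (sym p1≡o) p1≡2+y+o))
  ... | suc (suc x) , p≡2+y+o  = x , trans p≡2+y+o (sym (+-suc² y o))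

farIncreasing⇒toFun : ∀ {n o} {p : Fin n → ℕ} → IsShiftedPerm o p → FarIncreasing p →
  ∃ λ c → ∀ i → toℕ (toFun c i) + o ≡ p i
farIncreasing⇒toFun {zero} _ _ = [] , λ ()
farIncreasing⇒toFun {suc _} {o} sp far with firstBlock sp far
... | one p0≡o =
  let c , c≡p = farIncreasing⇒toFun (tail-one sp p0≡o) (FarIncreasing-∘suc far)
  in 1∷ c , λ { zero    → sym p0≡o
              ; (suc i) → trans (sym (+-suc _ o)) (c≡p i) }
... | twoOne p0≡1+o p1≡o =
  let c , c≡p = farIncreasing⇒toFun (tail-twoOne sp p0≡1+o p1≡o)
                                     (FarIncreasing-∘suc (FarIncreasing-∘suc far))
  in 2∷ c , λ { zero          → sym p0≡1+o
              ; (suc zero)    → sym p1≡o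
              ; (suc (suc i)) → trans (sym (+-suc² _ o)) (c≡p i) }

f-surjective : ∀ {n} (π : Vec (Fin n) n) → IsPerm π → Avoids P₃ π → ∃ λ c → f c ≡ π
f-surjective π (injective , surjective) avoids =
  let c , c≡π = farIncreasing⇒toFun sp (avoids⇒farIncreasing π injective avoids)
  in c , lookup-≗⇒≡ (f c) π λ i →
       trans (lookup-f c i) (toℕ-injective (trans (sym (+-identityʳ _)) (c≡π i)))
  where
  sp : IsShiftedPerm 0 (toℕ ∘ lookup π)
  sp = record
    { injective = injective ∘ toℕ-injective
    ; lower-bound   = λ _ → z≤n
    ; covers    = λ y y<n → let x , πx≡y = surjective (fromℕ< y<n) in
        x , trans (cong toℕ (πx≡y refl)) (trans (toℕ-fromℕ< y<n) (sym (+-identityʳ y)))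
    }

mainTheorem5 : (n : ℕ) → n ≥ 1 →
    ((c : Comp n) → IsPerm (f c) × Avoids P₃ (f c)) ×
    ((c d : Comp n) → f c ≡ f d → c ≡ d) ×
    ((π : Vec (Fin n) n) → IsPerm π → Avoids P₃ π → ∃ λ (c : Comp n) → f c ≡ π)
mainTheorem5 n _ =
  (λ c → f-isPerm c , f-avoids c) ,
  (λ c d → f-injective) ,
  f-surjective
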